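{- The generating function of closed Deutsch paths (Deutsch paths ending at level $0$), counted by length, is $\frac{1+v+v^2}{1+v}$ with $v=v(z)$ as defined below. Consequently, for every $n\ge0$ the number of closed Deutsch paths of length $n$ equals \[ \binom{n,3}{n}-\binom{n,3}{n-1}. \]
   Context: A Deutsch path of length $n$ is a lattice path starting at $(0,0)$ consisting of $n$ steps, each either an up-step $(1,1)$ or a down-step $(1,-k)$ for some integer $k\ge1$, which never goes below the $x$-axis. It is closed if it ends on the $x$-axis; the empty path is a closed Deutsch path of length $0$. Let $v=v(z)=\frac{1-z-\sqrt{1-2z-3z^2}}{2z}$, the formal power series satisfying $z=\frac{v}{1+v+v^2}$. The trinomial coefficient is $\binom{n,3}{k}=[v^k](1+v+v^2)^n$ (zero for $k<0$). -}

module Defs where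

open import Data.Nat using (ℕ; zero; suc; _≤_; _∸_)
open import Data.Integer as ℤ using (ℤ; +_; -[1+_]; _-_)
open import Data.List using (List; []; _∷_; length)
open import Data.List.Membership.Propositional using (_∈_)
open import Data.List.Relation.Unary.Unique.Propositional using (Unique)
open import Data.Product using (Σ; _×_; ∃-syntax)
open import Function.Bundles using (_⇔_)
open import Relation.Binary.PropositionalEquality using (_≡_)

-- A step: an up-step (1,1), or a down-step (1,-(k+1)) (so the drop is ≥ 1).
data Step : Set where
  up   : Step
  down : ℕ → Step

-- Walk h s e : the step sequence s, started at height h, never goes
-- below the x-axis and ends at height e.
data Walk : ℕ → List Step → ℕ → Set where
  nil    : ∀ {h} → Walk h [] h
  upStep : ∀ {h s e} → Walk (suc h) s e → Walk h (up ∷ s) e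
  dnStep : ∀ {h s e} (k : ℕ) → suc k ≤ h → Walk (h ∸ suc k) s e →
           Walk h (down k ∷ s) e

ClosedDeutsch : ℕ → List Step → Set
ClosedDeutsch n p = (length p ≡ n) × Walk 0 p 0

-- "The number of a satisfying P is m": a duplicate-free list of
-- exactly the elements satisfying P, of length m.
HasCount : {A : Set} → (A → Set) → ℕ → Set
HasCount {A} P m =
  ∃[ xs ] (Unique xs × (∀ (a : A) → (a ∈ xs ⇔ P a)) × (length xs ≡ m))

-- Trinomial coefficients  trinom n k = [v^k](1+v+v²)^n  (0 for k<0)

trinom : ℕ → ℤ → ℕ
trinom n       -[1+ _ ]      = 0
trinom zero    (+ zero)      = 1
trinom zero    (+ suc _)     = 0
trinom (suc n) (+ k)         =
  Data.Nat._+_ (Data.Nat._+_ (trinom n (+ k)) (trinom n ((+ k) - + 1)))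
               (trinom n ((+ k) - + 2))

FPS : Set
FPS = ℕ → ℤ

sumTo : ℕ → (ℕ → ℤ) → ℤ
sumTo zero    f = + 0
sumTo (suc m) f = sumTo m f ℤ.+ f m

infixl 6 _⊕_
infixl 7 _⊛_

_⊕_ : FPS → FPS → FPS
(f ⊕ g) n = f n ℤ.+ g n

_⊛_ : FPS → FPS → FPS
(f ⊛ g) n = sumTo (suc n) (λ i → f i ℤ.* g (n ∸ i))

one : FPS
one zero    = + 1
one (suc _) = + 0

zTimes : FPS → FPS
zTimes f zero    = + 0
zTimes f (suc n) = f n

infix 4 _≈_
_≈_ : FPS → FPS → Set
f ≈ g = ∀ n → f n ≡ g n

ogf : (ℕ → ℕ) → FPS
ogf c n = + (c n)

module Submission where

-- Let W(n,h) be the number of step sequences of length n that lead from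
-- height h down to height 0 without going below the x-axis; closed Deutsch
-- paths of length n are counted by W(n,0).  An explicit duplicate-free
-- enumeration shows these counts exist and obey
--   W(n+1,h) = W(n,h+1) + Σ_{j<h} W(n,j).
-- Taking forward differences in h turns this into a three-term recurrence:
-- the array  X(n,0) = W(n,0),  X(n,j+1) = Δʲ W(n,-)(1)  satisfies
--   X(0,j) = [j = 0],  X(n+1,0) = X(n,1),
--   X(n+1,j+1) = X(n,j+2) + X(n,j+1) + X(n,j)                       (★)
-- and (★) determines an array uniquely.  The array of differences of
-- central trinomial coefficients  T(n,n-j) - T(n,n-j-1)  satisfies (★) as
-- well (using the symmetry T(n,n+i) = T(n,n-i)), which gives the counting
-- formula.  For generating functions, every array obeying (★) has columns
-- Xⱼ(z) = C(z) u(z)ʲ with  u = z(X₀ + X₁);  this u solves u = z(1+u+u²),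
-- whose solution v is unique, and C(1+u) = X₀ + X₁ = 1+u+u².

open import Defs
open import Data.Nat as ℕ using (ℕ; zero; suc; _≤_; _<_; _∸_; z≤n; s≤s)
open import Data.Nat.Properties
  using (≤-refl; ≤-pred; m≤n⇒m≤1+n; m≤n⇒m<n∨m≡n; m∸n≤m; n∸n≡0; <-irrefl; +-identityʳ; +-assoc)
open import Data.Integer using (ℤ; +_; -[1+_]; _+_; _-_; _*_)
open import Data.Integer.Properties using (*-zeroʳ)
open import Data.Integer.Tactic.RingSolver using (solve-∀)
open import Data.List using (List; []; _∷_; length; map; _++_)
open import Data.List.Properties using (length-++; length-map; ∷-injectiveʳ)
open import Data.List.Membership.Propositional using (_∈_)
open import Data.List.Membership.Propositional.Properties
  using (∈-map⁺; ∈-map⁻; ∈-++⁺ˡ; ∈-++⁺ʳ; ∈-++⁻)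
open import Data.List.Membership.Propositional.Properties.WithK using (unique∧set⇒bag)
open import Data.List.Relation.Binary.BagAndSetEquality using (∼bag⇒↭)
open import Data.List.Relation.Binary.Permutation.Propositional.Properties using (↭-length)
open import Data.List.Relation.Unary.Any using (here)
open import Data.List.Relation.Unary.Unique.Propositional using (Unique; []; _∷_)
open import Data.List.Relation.Unary.Unique.Propositional.Properties using (map⁺; ++⁺)
open import Data.List.Relation.Unary.All using ([])
open import Data.Product using (_×_; _,_; ∃-syntax)
open import Data.Sum using (inj₁; inj₂)
open import Data.Empty using (⊥)
open import Function using (_∘_)
open import Function.Bundles using (_⇔_; mk⇔; Equivalence)
open import Relation.Binary.PropositionalEquality
  using (_≡_; refl; sym; trans; cong; cong₂; subst; module ≡-Reasoning)
open ≡-Reasoning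

-- Two duplicate-free lists with the same members have the same length,
-- so a predicate has at most one count.
count-unique : {A : Set} {P : A → Set} {m m′ : ℕ} →
               HasCount P m → HasCount P m′ → m ≡ m′
count-unique (xs , xs-unique , xs-spec , refl) (ys , ys-unique , ys-spec , refl) =
  ↭-length (∼bag⇒↭ (unique∧set⇒bag xs-unique ys-unique (λ {a} → mk⇔
    (Equivalence.from (ys-spec a) ∘ Equivalence.to (xs-spec a))
    (Equivalence.from (xs-spec a) ∘ Equivalence.to (ys-spec a)))))

mutual
  walks : ℕ → ℕ → List (List Step)
  walks zero    zero    = [] ∷ []
  walks zero    (suc h) = []
  walks (suc n) h       = map (up ∷_) (walks n (suc h)) ++ descents n h h

  -- descents n h k: the walks of length n+1 from height h whose first
  -- step is  down k′  for some k′ < k.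
  descents : ℕ → ℕ → ℕ → List (List Step)
  descents n h zero    = []
  descents n h (suc k) = descents n h k ++ map (down k ∷_) (walks n (h ∸ suc k))

descents-inversion : ∀ n h k {s} → s ∈ descents n h k →
  ∃[ k′ ] (k′ < k × ∃[ t ] (t ∈ walks n (h ∸ suc k′) × s ≡ down k′ ∷ t))
descents-inversion n h (suc k) s∈ with ∈-++⁻ (descents n h k) s∈
... | inj₁ s∈ₗ with descents-inversion n h k s∈ₗ
...   | k′ , k′<k , rest = k′ , m≤n⇒m≤1+n k′<k , rest
descents-inversion n h (suc k) s∈ | inj₂ s∈ᵣ with ∈-map⁻ (down k ∷_) s∈ᵣ
...   | t , t∈ , s≡ = k , ≤-refl , t , t∈ , s≡

descents-complete : ∀ n h {k k′ t} → k′ < k → t ∈ walks n (h ∸ suc k′) →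
                    down k′ ∷ t ∈ descents n h k
descents-complete n h {suc k} (s≤s k′≤k) t∈ with m≤n⇒m<n∨m≡n k′≤k
... | inj₁ k′<k = ∈-++⁺ˡ (descents-complete n h k′<k t∈)
... | inj₂ refl = ∈-++⁺ʳ (descents n h k) (∈-map⁺ (down k ∷_) t∈)

down-injective : ∀ {k k′} {s t : List Step} → down k ∷ s ≡ down k′ ∷ t → k ≡ k′
down-injective refl = refl

mutual
  -- The enumeration has no repetitions: the two parts of  walks (suc n) h
  -- differ in their first step, those of  descents  in the size of the drop.
  walks-unique : ∀ n h → Unique (walks n h)
  walks-unique zero    zero    = [] ∷ []
  walks-unique zero    (suc h) = []
  walks-unique (suc n) h       =
    ++⁺ (map⁺ ∷-injectiveʳ (walks-unique n (suc h))) (descents-unique n h h) disjoint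
    where
    disjoint : ∀ {s} → s ∈ map (up ∷_) (walks n (suc h)) × s ∈ descents n h h → ⊥
    disjoint (s∈ups , s∈downs) with ∈-map⁻ (up ∷_) s∈ups | descents-inversion n h h s∈downs
    ... | _ , _ , refl | _ , _ , _ , _ , ()

  descents-unique : ∀ n h k → Unique (descents n h k)
  descents-unique n h zero    = []
  descents-unique n h (suc k) =
    ++⁺ (descents-unique n h k) (map⁺ ∷-injectiveʳ (walks-unique n (h ∸ suc k))) disjoint
    where
    disjoint : ∀ {s} → s ∈ descents n h k × s ∈ map (down k ∷_) (walks n (h ∸ suc k)) → ⊥
    disjoint (s∈ₗ , s∈ᵣ) with ∈-map⁻ (down k ∷_) s∈ᵣ | descents-inversion n h k s∈ₗ
    ... | _ , _ , refl | _ , k′<k , _ , _ , s≡ = <-irrefl (sym (down-injective s≡)) k′<k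

walks-sound : ∀ n h {s} → s ∈ walks n h → length s ≡ n × Walk h s 0
walks-sound zero    zero    (here refl) = refl , nil
walks-sound (suc n) h       s∈ with ∈-++⁻ (map (up ∷_) (walks n (suc h))) s∈
... | inj₁ s∈ups with ∈-map⁻ (up ∷_) s∈ups
...   | t , t∈ , refl with walks-sound n (suc h) t∈
...     | len , walk = cong suc len , upStep walk
walks-sound (suc n) h s∈ | inj₂ s∈downs with descents-inversion n h h s∈downs
...   | k , k<h , t , t∈ , refl with walks-sound n (h ∸ suc k) t∈
...     | len , walk = cong suc len , dnStep k k<h walk

walks-complete : ∀ {h s} → Walk h s 0 → s ∈ walks (length s) h
walks-complete nil = here refl
walks-complete (upStep walk) = ∈-++⁺ˡ (∈-map⁺ (up ∷_) (walks-complete walk))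
walks-complete {h} {down k ∷ s} (dnStep k k<h walk) =
  ∈-++⁺ʳ (map (up ∷_) (walks (length s) (suc h)))
         (descents-complete (length s) h k<h (walks-complete walk))

nWalks : ℕ → ℕ → ℕ
nWalks n h = length (walks n h)

nDescents : ℕ → ℕ → ℕ → ℕ
nDescents n h k = length (descents n h k)

closedCount : ∀ n → HasCount (ClosedDeutsch n) (nWalks n 0)
closedCount n = walks n 0 , walks-unique n 0 , spec , refl
  where
  spec : ∀ s → s ∈ walks n 0 ⇔ ClosedDeutsch n s
  spec s = mk⇔ (walks-sound n 0)
               (λ { (len , walk) → subst (λ m → s ∈ walks m 0) len (walks-complete walk) })

nWalks-suc : ∀ n h → nWalks (suc n) h ≡ nWalks n (suc h) ℕ.+ nDescents n h h
nWalks-suc n h = trans (length-++ (map (up ∷_) (walks n (suc h))))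
                       (cong (ℕ._+ nDescents n h h) (length-map (up ∷_) (walks n (suc h))))

nDescents-suc : ∀ n h k → nDescents n h (suc k) ≡ nDescents n h k ℕ.+ nWalks n (h ∸ suc k)
nDescents-suc n h k = trans (length-++ (descents n h k))
                            (cong (nDescents n h k ℕ.+_) (length-map (down k ∷_) (walks n (h ∸ suc k))))

nDescents-shift : ∀ n h k → nDescents n (suc h) (suc k) ≡ nWalks n h ℕ.+ nDescents n h k
nDescents-shift n h zero    = trans (nDescents-suc n (suc h) 0) (sym (+-identityʳ (nWalks n h)))
nDescents-shift n h (suc k) = begin
  nDescents n (suc h) (suc (suc k))
    ≡⟨ nDescents-suc n (suc h) (suc k) ⟩
  nDescents n (suc h) (suc k) ℕ.+ nWalks n (h ∸ suc k)
    ≡⟨ cong (ℕ._+ nWalks n (h ∸ suc k)) (nDescents-shift n h k) ⟩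
  (nWalks n h ℕ.+ nDescents n h k) ℕ.+ nWalks n (h ∸ suc k)
    ≡⟨ +-assoc (nWalks n h) (nDescents n h k) (nWalks n (h ∸ suc k)) ⟩
  nWalks n h ℕ.+ (nDescents n h k ℕ.+ nWalks n (h ∸ suc k))
    ≡⟨ cong (nWalks n h ℕ.+_) (sym (nDescents-suc n h k)) ⟩
  nWalks n h ℕ.+ nDescents n h (suc k) ∎

-- The walk counts as integers, so that differences can be taken.
W : ℕ → ℕ → ℤ
W n h = + nWalks n h

walks-from-zero : ∀ n → W (suc n) 0 ≡ W n 1
walks-from-zero n = cong +_ (trans (nWalks-suc n 0) (+-identityʳ (nWalks n 1)))

walks-difference : ∀ n h →
  W (suc n) (suc h) - W (suc n) h ≡ (W n (suc (suc h)) - W n (suc h)) + W n h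
walks-difference n h = begin
  W (suc n) (suc h) - W (suc n) h
    ≡⟨ cong₂ _-_ (cong +_ (trans (nWalks-suc n (suc h))
                                 (cong (nWalks n (suc (suc h)) ℕ.+_) (nDescents-shift n h h))))
                 (cong +_ (nWalks-suc n h)) ⟩
  (W n (suc (suc h)) + (W n h + + nDescents n h h)) - (W n (suc h) + + nDescents n h h)
    ≡⟨ cancel (W n (suc (suc h))) (W n h) (W n (suc h)) (+ nDescents n h h) ⟩
  (W n (suc (suc h)) - W n (suc h)) + W n h ∎
  where
  cancel : ∀ a b c d → (a + (b + d)) - (c + d) ≡ (a - c) + b
  cancel = solve-∀

Δ : ℕ → (ℕ → ℤ) → ℕ → ℤ
Δ zero    f h = f h
Δ (suc k) f h = Δ k f (suc h) - Δ k f h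

Δ-vanish : ∀ (f : ℕ → ℤ) → (∀ h → f (suc h) ≡ + 0) → ∀ k h → Δ k f (suc h) ≡ + 0
Δ-vanish f f≡0 zero    h = f≡0 h
Δ-vanish f f≡0 (suc k) h = cong₂ _-_ (Δ-vanish f f≡0 k (suc h)) (Δ-vanish f f≡0 k h)

Δ-step : ∀ (f g : ℕ → ℤ) →
  (∀ h → f (suc h) - f h ≡ (g (suc (suc h)) - g (suc h)) + g h) →
  ∀ k h → Δ (suc k) f h ≡ Δ (suc k) g (suc h) + Δ k g h
Δ-step f g base zero    h = base h
Δ-step f g base (suc k) h = begin
  Δ (suc k) f (suc h) - Δ (suc k) f h
    ≡⟨ cong₂ _-_ (Δ-step f g base k (suc h)) (Δ-step f g base k h) ⟩
  (Δ (suc k) g (suc (suc h)) + Δ k g (suc h)) - (Δ (suc k) g (suc h) + Δ k g h)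
    ≡⟨ regroup (Δ (suc k) g (suc (suc h))) (Δ k g (suc h)) (Δ (suc k) g (suc h)) (Δ k g h) ⟩
  Δ (suc (suc k)) g (suc h) + Δ (suc k) g h ∎
  where
  regroup : ∀ a b c d → (a + b) - (c + d) ≡ (a - c) + (b - d)
  regroup = solve-∀

record IsDeutschArray (X : ℕ → ℕ → ℤ) : Set where
  field
    row₀ : ∀ j → X 0 j ≡ one j
    col₀ : ∀ n → X (suc n) 0 ≡ X n 1
    step : ∀ n j → X (suc n) (suc j) ≡ X n (suc (suc j)) + X n (suc j) + X n j

array-unique : ∀ {X Y} → IsDeutschArray X → IsDeutschArray Y → ∀ n j → X n j ≡ Y n j
array-unique {X} {Y} isX isY = unique
  where
  module ★X = IsDeutschArray isX
  module ★Y = IsDeutschArray isY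

  unique : ∀ n j → X n j ≡ Y n j
  unique zero    j       = trans (★X.row₀ j) (sym (★Y.row₀ j))
  unique (suc n) zero    = trans (★X.col₀ n) (trans (unique n 1) (sym (★Y.col₀ n)))
  unique (suc n) (suc j) = begin
    X (suc n) (suc j)                          ≡⟨ ★X.step n j ⟩
    X n (suc (suc j)) + X n (suc j) + X n j    ≡⟨ cong₂ _+_ (cong₂ _+_ (unique n (suc (suc j))) (unique n (suc j)))
                                                            (unique n j) ⟩
    Y n (suc (suc j)) + Y n (suc j) + Y n j    ≡⟨ sym (★Y.step n j) ⟩
    Y (suc n) (suc j) ∎

pathArray : ℕ → ℕ → ℤ
pathArray n zero    = W n 0
pathArray n (suc j) = Δ j (W n) 1

pathArray-isDeutsch : IsDeutschArray pathArray
pathArray-isDeutsch = record { row₀ = row₀ ; col₀ = walks-from-zero ; step = step }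
  where
  row₀ : ∀ j → pathArray 0 j ≡ one j
  row₀ zero    = refl
  row₀ (suc j) = Δ-vanish (W 0) (λ _ → refl) j 0

  step : ∀ n j → pathArray (suc n) (suc j) ≡
                 pathArray n (suc (suc j)) + pathArray n (suc j) + pathArray n j
  step n zero    = begin
    W (suc n) 1                                          ≡⟨ split (W (suc n) 1) (W (suc n) 0) ⟩
    (W (suc n) 1 - W (suc n) 0) + W (suc n) 0            ≡⟨ cong₂ _+_ (walks-difference n 0) (walks-from-zero n) ⟩
    ((W n 2 - W n 1) + W n 0) + W n 1                    ≡⟨ swap (W n 2 - W n 1) (W n 0) (W n 1) ⟩
    (W n 2 - W n 1) + W n 1 + W n 0 ∎
    where
    split : ∀ a b → a ≡ (a - b) + b
    split = solve-∀
    swap : ∀ a b c → (a + b) + c ≡ a + c + b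
    swap = solve-∀
  step n (suc k) = begin
    Δ (suc k) (W (suc n)) 1                              ≡⟨ Δ-step (W (suc n)) (W n) (walks-difference n) k 1 ⟩
    Δ (suc k) (W n) 2 + Δ k (W n) 1                      ≡⟨ split (Δ (suc k) (W n) 2) (Δ (suc k) (W n) 1) (Δ k (W n) 1) ⟩
    Δ (suc (suc k)) (W n) 1 + Δ (suc k) (W n) 1 + Δ k (W n) 1 ∎
    where
    split : ∀ a b c → a + c ≡ (a - b) + b + c
    split = solve-∀

tri : ℕ → ℤ → ℤ
tri n k = + trinom n k

trinom-suc : ∀ n k → tri (suc n) k ≡ tri n k + tri n (k - + 1) + tri n (k - + 2)
trinom-suc n (+ _)    = refl
trinom-suc n -[1+ _ ] = refl

-- (1+v+v²)ⁿ is palindromic of degree 2n.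
trinom-symmetric : ∀ n i → tri n (+ n + i) ≡ tri n (+ n - i)
trinom-symmetric zero    (+ zero)  = refl
trinom-symmetric zero    (+ suc _) = refl
trinom-symmetric zero    -[1+ _ ]  = refl
trinom-symmetric (suc n) i = begin
  tri (suc n) (+ suc n + i)
    ≡⟨ trinom-suc n (+ suc n + i) ⟩
  tri n (+ suc n + i) + tri n (+ suc n + i - + 1) + tri n (+ suc n + i - + 2)
    ≡⟨ cong₂ _+_ (cong₂ _+_ (cong (tri n) (idx₁ (+ n) i)) (cong (tri n) (idx₂ (+ n) i)))
                 (cong (tri n) (idx₃ (+ n) i)) ⟩
  tri n (+ n + (i + + 1)) + tri n (+ n + i) + tri n (+ n + (i - + 1))
    ≡⟨ cong₂ _+_ (cong₂ _+_ (IH (i + + 1)) (IH i)) (IH (i - + 1)) ⟩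
  tri n (+ n - (i + + 1)) + tri n (+ n - i) + tri n (+ n - (i - + 1))
    ≡⟨ cong₂ _+_ (cong₂ _+_ (cong (tri n) (idx₄ (+ n) i)) (cong (tri n) (idx₅ (+ n) i)))
                 (cong (tri n) (idx₆ (+ n) i)) ⟩
  tri n (+ suc n - i - + 2) + tri n (+ suc n - i - + 1) + tri n (+ suc n - i)
    ≡⟨ reverse (tri n (+ suc n - i - + 2)) (tri n (+ suc n - i - + 1)) (tri n (+ suc n - i)) ⟩
  tri n (+ suc n - i) + tri n (+ suc n - i - + 1) + tri n (+ suc n - i - + 2)
    ≡⟨ sym (trinom-suc n (+ suc n - i)) ⟩
  tri (suc n) (+ suc n - i) ∎
  where
  IH : ∀ i → tri n (+ n + i) ≡ tri n (+ n - i)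
  IH = trinom-symmetric n
  idx₁ : ∀ x i → (+ 1 + x) + i ≡ x + (i + + 1)
  idx₁ = solve-∀
  idx₂ : ∀ x i → (+ 1 + x) + i - + 1 ≡ x + i
  idx₂ = solve-∀
  idx₃ : ∀ x i → (+ 1 + x) + i - + 2 ≡ x + (i - + 1)
  idx₃ = solve-∀
  idx₄ : ∀ x i → x - (i + + 1) ≡ (+ 1 + x) - i - + 2
  idx₄ = solve-∀
  idx₅ : ∀ x i → x - i ≡ (+ 1 + x) - i - + 1
  idx₅ = solve-∀
  idx₆ : ∀ x i → x - (i - + 1) ≡ (+ 1 + x) - i
  idx₆ = solve-∀
  reverse : ∀ a b c → a + b + c ≡ c + b + a
  reverse = solve-∀

tdiff : ℕ → ℤ → ℤ
tdiff n k = tri n k - tri n (k - + 1)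

tdiff-suc : ∀ n k → tdiff (suc n) k ≡ tdiff n k + tdiff n (k - + 1) + tdiff n (k - + 2)
tdiff-suc n k = begin
  tri (suc n) k - tri (suc n) (k - + 1)
    ≡⟨ cong₂ _-_ (trinom-suc n k) (trinom-suc n (k - + 1)) ⟩
  (a + b + c) - (b + tri n (k - + 1 - + 1) + tri n (k - + 1 - + 2))
    ≡⟨ cong (λ e → (a + b + c) - e)
            (cong₂ _+_ (cong (_+_ (b)) (cong (tri n) (idx₁ k))) (cong (tri n) (idx₂ k))) ⟩
  (a + b + c) - (b + c + d)
    ≡⟨ telescope a b c d ⟩
  (a - b) + (b - c) + (c - d)
    ≡⟨ cong (λ e → (a - b) + (b - e) + (c - d)) (sym (cong (tri n) (idx₁ k))) ⟩
  (a - b) + (b - tri n (k - + 1 - + 1)) + (c - d) ∎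
  where
  a = tri n k
  b = tri n (k - + 1)
  c = tri n (k - + 2)
  d = tri n (k - + 2 - + 1)
  idx₁ : ∀ k → k - + 1 - + 1 ≡ k - + 2
  idx₁ = solve-∀
  idx₂ : ∀ k → k - + 1 - + 2 ≡ k - + 2 - + 1
  idx₂ = solve-∀
  telescope : ∀ a b c d → (a + b + c) - (b + c + d) ≡ (a - b) + (b - c) + (c - d)
  telescope = solve-∀

triArray : ℕ → ℕ → ℤ
triArray n j = tdiff n (+ n - + j)

triArray-zero : ∀ n → triArray n 0 ≡ tri n (+ n) - tri n (+ n - + 1)
triArray-zero n = cong (tdiff n) (minus-zero (+ n))
  where
  minus-zero : ∀ x → x - + 0 ≡ x
  minus-zero = solve-∀

triArray-isDeutsch : IsDeutschArray triArray
triArray-isDeutsch = record { row₀ = row₀ ; col₀ = col₀ ; step = step }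
  where
  row₀ : ∀ j → triArray 0 j ≡ one j
  row₀ zero    = refl
  row₀ (suc j) = refl

  -- The two differences straddling the centre cancel by symmetry.
  col₀ : ∀ n → triArray (suc n) 0 ≡ triArray n 1
  col₀ n = begin
    tdiff (suc n) (+ suc n - + 0)
      ≡⟨ trans (cong (tdiff (suc n)) (idx₁ (+ n))) (tdiff-suc n (+ n + + 1)) ⟩
    tdiff n (+ n + + 1) + tdiff n (+ n + + 1 - + 1) + tdiff n (+ n + + 1 - + 2)
      ≡⟨ cong₂ _+_ (cong (_+_ (tdiff n (+ n + + 1))) (cong (tdiff n) (idx₂ (+ n))))
                   (cong (tdiff n) (idx₃ (+ n))) ⟩
    (tri n (+ n + + 1) - tri n (+ n + + 1 - + 1)) + (tri n (+ n) - tri n (+ n - + 1)) + triArray n 1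
      ≡⟨ cong (λ e → (tri n (+ n + + 1) - e) + (tri n (+ n) - tri n (+ n - + 1)) + triArray n 1)
              (cong (tri n) (idx₂ (+ n))) ⟩
    (tri n (+ n + + 1) - tri n (+ n)) + (tri n (+ n) - tri n (+ n - + 1)) + triArray n 1
      ≡⟨ cong (λ e → (e - tri n (+ n)) + (tri n (+ n) - tri n (+ n - + 1)) + triArray n 1)
              (trinom-symmetric n (+ 1)) ⟩
    (tri n (+ n - + 1) - tri n (+ n)) + (tri n (+ n) - tri n (+ n - + 1)) + triArray n 1
      ≡⟨ cancel (tri n (+ n - + 1)) (tri n (+ n)) (triArray n 1) ⟩
    triArray n 1 ∎
    where
    idx₁ : ∀ x → (+ 1 + x) - + 0 ≡ x + + 1
    idx₁ = solve-∀
    idx₂ : ∀ x → x + + 1 - + 1 ≡ x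
    idx₂ = solve-∀
    idx₃ : ∀ x → x + + 1 - + 2 ≡ x - + 1
    idx₃ = solve-∀
    cancel : ∀ a b c → (a - b) + (b - a) + c ≡ c
    cancel = solve-∀

  step : ∀ n j → triArray (suc n) (suc j) ≡
                 triArray n (suc (suc j)) + triArray n (suc j) + triArray n j
  step n j = begin
    tdiff (suc n) (+ suc n - + suc j)
      ≡⟨ trans (cong (tdiff (suc n)) (idx₁ (+ n) (+ j))) (tdiff-suc n (+ n - + j)) ⟩
    tdiff n (+ n - + j) + tdiff n (+ n - + j - + 1) + tdiff n (+ n - + j - + 2)
      ≡⟨ cong₂ _+_ (cong (_+_ (triArray n j)) (cong (tdiff n) (idx₂ (+ n) (+ j))))
                   (cong (tdiff n) (idx₃ (+ n) (+ j))) ⟩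
    triArray n j + triArray n (suc j) + triArray n (suc (suc j))
      ≡⟨ reverse (triArray n j) (triArray n (suc j)) (triArray n (suc (suc j))) ⟩
    triArray n (suc (suc j)) + triArray n (suc j) + triArray n j ∎
    where
    idx₁ : ∀ x y → (+ 1 + x) - (+ 1 + y) ≡ x - y
    idx₁ = solve-∀
    idx₂ : ∀ x y → x - y - + 1 ≡ x - (+ 1 + y)
    idx₂ = solve-∀
    idx₃ : ∀ x y → x - y - + 2 ≡ x - (+ 1 + (+ 1 + y))
    idx₃ = solve-∀
    reverse : ∀ a b c → a + b + c ≡ c + b + a
    reverse = solve-∀

sumTo-cong : ∀ m {f g : ℕ → ℤ} → (∀ i → i < m → f i ≡ g i) → sumTo m f ≡ sumTo m g
sumTo-cong zero    f≡g = refl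
sumTo-cong (suc m) f≡g = cong₂ _+_ (sumTo-cong m (λ i i<m → f≡g i (m≤n⇒m≤1+n i<m))) (f≡g m ≤-refl)

sumTo-zero : ∀ m {f : ℕ → ℤ} → (∀ i → i < m → f i ≡ + 0) → sumTo m f ≡ + 0
sumTo-zero m f≡0 = trans (sumTo-cong m f≡0) (all-zero m)
  where
  all-zero : ∀ m → sumTo m (λ _ → + 0) ≡ + 0
  all-zero zero    = refl
  all-zero (suc m) = cong (_+ + 0) (all-zero m)

sumTo-+ : ∀ m (f g : ℕ → ℤ) → sumTo m (λ i → f i + g i) ≡ sumTo m f + sumTo m g
sumTo-+ zero    f g = refl
sumTo-+ (suc m) f g = trans (cong (_+ (f m + g m)) (sumTo-+ m f g))
                            (interchange (sumTo m f) (sumTo m g) (f m) (g m))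
  where
  interchange : ∀ a b c d → (a + b) + (c + d) ≡ (a + c) + (b + d)
  interchange = solve-∀

sumTo-head : ∀ m (f : ℕ → ℤ) → sumTo (suc m) f ≡ f 0 + sumTo m (f ∘ suc)
sumTo-head zero    f = sym (identity (f 0))
  where
  identity : ∀ a → a + + 0 ≡ + 0 + a
  identity = solve-∀
sumTo-head (suc m) f = trans (cong (_+ f (suc m)) (sumTo-head m f))
                             (assoc (f 0) (sumTo m (f ∘ suc)) (f (suc m)))
  where
  assoc : ∀ a b c → (a + b) + c ≡ a + (b + c)
  assoc = solve-∀

⊛-zero : ∀ f g → (f ⊛ g) 0 ≡ f 0 * g 0
⊛-zero f g = identity (f 0 * g 0)
  where
  identity : ∀ a → + 0 + a ≡ a
  identity = solve-∀

⊛-suc : ∀ f g n → (f ⊛ g) (suc n) ≡ f 0 * g (suc n) + ((f ∘ suc) ⊛ g) n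
⊛-suc f g n = sumTo-head (suc n) (λ i → f i * g (suc n ∸ i))

⊛-cong-upTo : ∀ {f f′ g g′ : FPS} n →
  (∀ i → i ≤ n → f i ≡ f′ i) → (∀ i → i ≤ n → g i ≡ g′ i) → (f ⊛ g) n ≡ (f′ ⊛ g′) n
⊛-cong-upTo n f≡ g≡ =
  sumTo-cong (suc n) (λ i i<1+n → cong₂ _*_ (f≡ i (≤-pred i<1+n)) (g≡ (n ∸ i) (m∸n≤m n i)))

⊛-cong : ∀ {f f′ g g′ : FPS} → f ≈ f′ → g ≈ g′ → f ⊛ g ≈ f′ ⊛ g′
⊛-cong f≈ g≈ n = ⊛-cong-upTo n (λ i _ → f≈ i) (λ i _ → g≈ i)

⊛-congˡ : ∀ {f f′ : FPS} g → f ≈ f′ → f ⊛ g ≈ f′ ⊛ g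
⊛-congˡ g f≈ = ⊛-cong {g = g} f≈ (λ _ → refl)

⊕-cong : ∀ {f f′ g g′ : FPS} → f ≈ f′ → g ≈ g′ → f ⊕ g ≈ f′ ⊕ g′
⊕-cong f≈ g≈ n = cong₂ _+_ (f≈ n) (g≈ n)

⊕-congʳ : ∀ f {g g′ : FPS} → g ≈ g′ → f ⊕ g ≈ f ⊕ g′
⊕-congʳ f g≈ = ⊕-cong {f = f} (λ _ → refl) g≈

⊛-distribʳ : ∀ f g h → (f ⊕ g) ⊛ h ≈ f ⊛ h ⊕ g ⊛ h
⊛-distribʳ f g h n =
  trans (sumTo-cong (suc n) (λ i _ → distrib (f i) (g i) (h (n ∸ i))))
        (sumTo-+ (suc n) (λ i → f i * h (n ∸ i)) (λ i → g i * h (n ∸ i)))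
  where
  distrib : ∀ a b c → (a + b) * c ≡ a * c + b * c
  distrib = solve-∀

⊛-distribˡ : ∀ f g h → f ⊛ (g ⊕ h) ≈ f ⊛ g ⊕ f ⊛ h
⊛-distribˡ f g h n =
  trans (sumTo-cong (suc n) (λ i _ → distrib (f i) (g (n ∸ i)) (h (n ∸ i))))
        (sumTo-+ (suc n) (λ i → f i * g (n ∸ i)) (λ i → f i * h (n ∸ i)))
  where
  distrib : ∀ a b c → a * (b + c) ≡ a * b + a * c
  distrib = solve-∀

⊛-identityʳ : ∀ f → f ⊛ one ≈ f
⊛-identityʳ f n = begin
  sumTo n (λ i → f i * one (n ∸ i)) + f n * one (n ∸ n)
    ≡⟨ cong₂ _+_ (sumTo-zero n (λ i i<n → trans (cong (f i *_) (one-beyond i<n)) (*-zeroʳ (f i))))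
                 (cong (λ k → f n * one k) (n∸n≡0 n)) ⟩
  + 0 + f n * + 1
    ≡⟨ identity (f n) ⟩
  f n ∎
  where
  one-beyond : ∀ {i n} → i < n → one (n ∸ i) ≡ + 0
  one-beyond {zero}  (s≤s _)   = refl
  one-beyond {suc i} (s≤s i<n) = one-beyond i<n
  identity : ∀ a → + 0 + a * + 1 ≡ a
  identity = solve-∀

zTimes-⊛ : ∀ f g → zTimes f ⊛ g ≈ zTimes (f ⊛ g)
zTimes-⊛ f g zero    = ⊛-zero (zTimes f) g
zTimes-⊛ f g (suc n) = trans (⊛-suc (zTimes f) g n) (identity ((f ⊛ g) n))
  where
  identity : ∀ a → + 0 * g (suc n) + a ≡ a
  identity = solve-∀

-- The equation  v = z(1 + v + v²)  has at most one solution, since its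
-- right-hand side at index n+1 only involves coefficients up to n.
fixpoint-unique : ∀ {v w : FPS} →
  v ≈ zTimes (one ⊕ v ⊕ v ⊛ v) → w ≈ zTimes (one ⊕ w ⊕ w ⊛ w) → v ≈ w
fixpoint-unique {v} {w} v≈ w≈ n = agree n n ≤-refl
  where
  agree : ∀ n k → k ≤ n → v k ≡ w k
  agree zero    .zero z≤n = trans (v≈ 0) (sym (w≈ 0))
  agree (suc n) k k≤1+n with m≤n⇒m<n∨m≡n k≤1+n
  ... | inj₁ k<1+n = agree n k (≤-pred k<1+n)
  ... | inj₂ refl  = begin
    v (suc n)                    ≡⟨ v≈ (suc n) ⟩
    one n + v n + (v ⊛ v) n      ≡⟨ cong₂ _+_ (cong (_+_ (one n)) (agree n n ≤-refl))
                                              (⊛-cong-upTo n (agree n) (agree n)) ⟩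
    one n + w n + (w ⊛ w) n      ≡⟨ sym (w≈ (suc n)) ⟩
    w (suc n) ∎

column : (ℕ → ℕ → ℤ) → ℕ → FPS
column X j n = X n j

-- u = z (X₀ + X₁), the candidate for the series v.
vSeries : (ℕ → ℕ → ℤ) → FPS
vSeries X = zTimes (column X 0 ⊕ column X 1)

module ArraySeries {X : ℕ → ℕ → ℤ} (isX : IsDeutschArray X) where
  open IsDeutschArray isX

  u : FPS
  u = vSeries X

  column-⊛ : ∀ n j → (column X j ⊛ u) n ≡ X n (suc j)
  column-⊛ zero j = begin
    (column X j ⊛ u) 0           ≡⟨ ⊛-zero (column X j) u ⟩
    X 0 j * + 0                  ≡⟨ *-zeroʳ (X 0 j) ⟩
    + 0                          ≡⟨ sym (row₀ (suc j)) ⟩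
    X 0 (suc j) ∎
  column-⊛ (suc n) zero = begin
    (column X 0 ⊛ u) (suc n)
      ≡⟨ ⊛-suc (column X 0) u n ⟩
    X 0 0 * u (suc n) + ((column X 0 ∘ suc) ⊛ u) n
      ≡⟨ cong₂ _+_ (cong (_* u (suc n)) (row₀ 0)) (⊛-congˡ u shift n) ⟩
    + 1 * (X n 0 + X n 1) + (column X 1 ⊛ u) n
      ≡⟨ cong (_+_ (+ 1 * (X n 0 + X n 1))) (column-⊛ n 1) ⟩
    + 1 * (X n 0 + X n 1) + X n 2
      ≡⟨ regroup (X n 0) (X n 1) (X n 2) ⟩
    X n 2 + X n 1 + X n 0
      ≡⟨ sym (step n 0) ⟩
    X (suc n) 1 ∎
    where
    shift : column X 0 ∘ suc ≈ column X 1
    shift = col₀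
    regroup : ∀ a b c → + 1 * (a + b) + c ≡ c + b + a
    regroup = solve-∀
  column-⊛ (suc n) (suc k) = begin
    (column X (suc k) ⊛ u) (suc n)
      ≡⟨ ⊛-suc (column X (suc k)) u n ⟩
    X 0 (suc k) * u (suc n) + ((column X (suc k) ∘ suc) ⊛ u) n
      ≡⟨ cong₂ _+_ (cong (_* u (suc n)) (row₀ (suc k))) (⊛-congˡ u shift n) ⟩
    + 0 * u (suc n) + ((a ⊕ b ⊕ c) ⊛ u) n
      ≡⟨ cong (_+_ (+ 0 * u (suc n))) (trans (⊛-distribʳ (a ⊕ b) c u n)
                                             (cong (_+ (c ⊛ u) n) (⊛-distribʳ a b u n))) ⟩
    + 0 * u (suc n) + ((a ⊛ u) n + (b ⊛ u) n + (c ⊛ u) n)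
      ≡⟨ cong (_+_ (+ 0 * u (suc n))) (cong₂ _+_ (cong₂ _+_ (column-⊛ n (suc (suc k))) (column-⊛ n (suc k)))
                                                 (column-⊛ n k)) ⟩
    + 0 * u (suc n) + (X n (suc (suc (suc k))) + X n (suc (suc k)) + X n (suc k))
      ≡⟨ identity (u (suc n)) _ ⟩
    X n (suc (suc (suc k))) + X n (suc (suc k)) + X n (suc k)
      ≡⟨ sym (step n (suc k)) ⟩
    X (suc n) (suc (suc k)) ∎
    where
    a = column X (suc (suc k))
    b = column X (suc k)
    c = column X k
    shift : column X (suc k) ∘ suc ≈ a ⊕ b ⊕ c
    shift i = step i k
    identity : ∀ a b → + 0 * a + b ≡ b
    identity = solve-∀

  u²-columns : ∀ n → (u ⊛ u) n ≡ zTimes (column X 1 ⊕ column X 2) n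
  u²-columns zero    = zTimes-⊛ (column X 0 ⊕ column X 1) u 0
  u²-columns (suc n) = begin
    (u ⊛ u) (suc n)                                ≡⟨ zTimes-⊛ (column X 0 ⊕ column X 1) u (suc n) ⟩
    ((column X 0 ⊕ column X 1) ⊛ u) n              ≡⟨ ⊛-distribʳ (column X 0) (column X 1) u n ⟩
    (column X 0 ⊛ u) n + (column X 1 ⊛ u) n        ≡⟨ cong₂ _+_ (column-⊛ n 0) (column-⊛ n 1) ⟩
    X n 1 + X n 2 ∎

  u-equation : u ≈ zTimes (one ⊕ u ⊕ u ⊛ u)
  u-equation zero = refl
  u-equation (suc zero) = begin
    X 0 0 + X 0 1                ≡⟨ cong₂ _+_ (row₀ 0) (row₀ 1) ⟩
    + 1 + + 0 + + 0              ≡⟨ cong (_+_ (+ 1 + + 0)) (sym (u²-columns 0)) ⟩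
    + 1 + + 0 + (u ⊛ u) 0 ∎
  u-equation (suc (suc n)) = begin
    X (suc n) 0 + X (suc n) 1
      ≡⟨ cong₂ _+_ (col₀ n) (step n 0) ⟩
    X n 1 + (X n 2 + X n 1 + X n 0)
      ≡⟨ regroup (X n 0) (X n 1) (X n 2) ⟩
    + 0 + (X n 0 + X n 1) + (X n 1 + X n 2)
      ≡⟨ cong (_+_ (+ 0 + (X n 0 + X n 1))) (sym (u²-columns (suc n))) ⟩
    + 0 + u (suc n) + (u ⊛ u) (suc n) ∎
    where
    regroup : ∀ a b c → b + (c + b + a) ≡ + 0 + (a + b) + (b + c)
    regroup = solve-∀

  gf-identity : column X 0 ⊛ (one ⊕ u) ≈ one ⊕ u ⊕ u ⊛ u
  gf-identity n = begin
    (column X 0 ⊛ (one ⊕ u)) n                 ≡⟨ ⊛-distribˡ (column X 0) one u n ⟩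
    (column X 0 ⊛ one) n + (column X 0 ⊛ u) n  ≡⟨ cong₂ _+_ (⊛-identityʳ (column X 0) n) (column-⊛ n 0) ⟩
    u (suc n)                                  ≡⟨ u-equation (suc n) ⟩
    (one ⊕ u ⊕ u ⊛ u) n ∎

mainTheorem2 : (∀ (n : ℕ) → ∃[ m ] HasCount (ClosedDeutsch n) m)
    ×
    (∀ (c : ℕ → ℕ) → (∀ n → HasCount (ClosedDeutsch n) (c n)) →
    ∀ (v : FPS) → v ≈ zTimes (one ⊕ v ⊕ v ⊛ v) →
    ogf c ⊛ (one ⊕ v) ≈ one ⊕ v ⊕ v ⊛ v)
    ×
    (∀ (c : ℕ → ℕ) → (∀ n → HasCount (ClosedDeutsch n) (c n)) →
    ∀ (n : ℕ) → + (c n) ≡ + (trinom n (+ n)) - + (trinom n (+ n - + 1)))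
mainTheorem2 = (λ n → nWalks n 0 , closedCount n) , generatingFunction , coefficients
  where
  open ArraySeries pathArray-isDeutsch using (u; u-equation; gf-identity)

  counts-are-column₀ : ∀ c → (∀ n → HasCount (ClosedDeutsch n) (c n)) → ogf c ≈ column pathArray 0
  counts-are-column₀ c count n = cong +_ (count-unique (count n) (closedCount n))

  generatingFunction : ∀ c → (∀ n → HasCount (ClosedDeutsch n) (c n)) →
    ∀ v → v ≈ zTimes (one ⊕ v ⊕ v ⊛ v) → ogf c ⊛ (one ⊕ v) ≈ one ⊕ v ⊕ v ⊛ v
  generatingFunction c count v v-equation n = begin
    (ogf c ⊛ (one ⊕ v)) n               ≡⟨ ⊛-cong (counts-are-column₀ c count) (⊕-congʳ one v≈u) n ⟩
    (column pathArray 0 ⊛ (one ⊕ u)) n  ≡⟨ gf-identity n ⟩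
    (one ⊕ u ⊕ u ⊛ u) n                 ≡⟨ sym (⊕-cong (⊕-congʳ one v≈u) (⊛-cong v≈u v≈u) n) ⟩
    (one ⊕ v ⊕ v ⊛ v) n ∎
    where
    v≈u : v ≈ u
    v≈u = fixpoint-unique v-equation u-equation

  coefficients : ∀ c → (∀ n → HasCount (ClosedDeutsch n) (c n)) →
    ∀ n → + (c n) ≡ + (trinom n (+ n)) - + (trinom n (+ n - + 1))
  coefficients c count n = begin
    + c n           ≡⟨ counts-are-column₀ c count n ⟩
    pathArray n 0   ≡⟨ array-unique pathArray-isDeutsch triArray-isDeutsch n 0 ⟩
    triArray n 0    ≡⟨ triArray-zero n ⟩
    + trinom n (+ n) - + trinom n (+ n - + 1) ∎
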